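{- Let $r\ge3$ and $1<s\le r$ be integers, let $a_1,\dots,a_r\in\Omega$ be defined recursively by $a_1=(a_r,\mathrm{id})\sigma$, $a_i=(\mathrm{id},a_{i-1})$ for $2\le i\le s-1$, $a_s=(\mathrm{id},a_{s-1})\sigma$, $a_i=(a_{i-1},\mathrm{id})$ for $s+1\le i\le r$, and let $G$ be the closed subgroup of $\Omega$ topologically generated by $a_1,\dots,a_r$. Let $n\ge1$. Suppose $b_1,\dots,b_r\in\Omega_n$ are such that $b_i$ is conjugate in $\Omega_n$ to $a_i|_{T_n}$ for all $1\le i\le r$, and that $b_{\tau(1)}b_{\tau(2)}\cdots b_{\tau(r)}=\mathrm{id}$ for some permutation $\tau\in S_r$. Then there exist $\phi\in\Omega_n$ and $x_1,\dots,x_r\in G_n$ such that $b_i=(\phi x_i)(a_i|_{T_n})(\phi x_i)^{ -1}$ for all $1\le i\le r$.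
   Context: $T$ is the regular rooted binary tree whose vertices are finite words over $\{0,1\}$; $T_n$ is the finite subtree of words of length $\le n$; $\Omega=\mathrm{Aut}(T)$, $\Omega_n=\mathrm{Aut}(T_n)$, and $\gamma|_{T_n}$ is the restriction of $\gamma\in\Omega$ to $T_n$; $G_n=\{g|_{T_n}:g\in G\}$. Automorphisms act on the right and $\gamma\gamma'$ means first $\gamma$ then $\gamma'$. Every $\gamma\in\Omega$ is written uniquely as $(\gamma_0,\gamma_1)\tau$ with $\tau\in\{\mathrm{id},\sigma\}=S_2$, meaning $(xv)\gamma=(x)\tau\,(v)\gamma_x$ for a letter $x$ and word $v$; $\sigma=(\mathrm{id},\mathrm{id})\sigma$ swaps $0$ and $1$ at the first letter. Multiplication: $(\gamma_0,\gamma_1)\tau\cdot(\gamma_0',\gamma_1')\tau'=(\gamma_0\gamma'_{(0)\tau},\gamma_1\gamma'_{(1)\tau})\tau\tau'$. $\Omega$ carries the profinite topology. -}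

module Defs where

open import Data.Nat using (ℕ; zero; suc; _∸_; _≡ᵇ_; _<ᵇ_)
open import Data.Bool using (Bool; true; false; if_then_else_; _xor_)
open import Data.Fin using (Fin; toℕ)
open import Data.List using (List; []; _∷_; foldr; map; allFin)
open import Data.Product using (Σ; ∃; _×_; _,_)
open import Relation.Binary.PropositionalEquality using (_≡_)

-- Aut n : automorphisms of the finite binary tree T_n, in portrait form.
-- node g₀ g₁ τ  represents (g₀ , g₁) τ, with τ = true meaning σ (swap).
data Aut : ℕ → Set where
  leaf : Aut zero
  node : ∀ {n} → Aut n → Aut n → Bool → Aut (suc n)

idA : ∀ {n} → Aut n
idA {zero}  = leaf
idA {suc n} = node idA idA false

-- (g₀,g₁)τ · (h₀,h₁)τ' = (g₀ h_{(0)τ} , g₁ h_{(1)τ}) ττ'   (first left, then right)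
infixl 7 _·_
_·_ : ∀ {n} → Aut n → Aut n → Aut n
leaf · leaf = leaf
node g₀ g₁ false · node h₀ h₁ τ' = node (g₀ · h₀) (g₁ · h₁) τ'
node g₀ g₁ true  · node h₀ h₁ τ' = node (g₀ · h₁) (g₁ · h₀) (true xor τ')

infix 8 _⁻¹
_⁻¹ : ∀ {n} → Aut n → Aut n
leaf ⁻¹ = leaf
node g₀ g₁ false ⁻¹ = node (g₀ ⁻¹) (g₁ ⁻¹) false
node g₀ g₁ true  ⁻¹ = node (g₁ ⁻¹) (g₀ ⁻¹) true

-- gen r s n i = a_i |_{T_n}   (1-indexed i, 1 ≤ i ≤ r), computed from the recursion
--   a_1 = (a_r , id) σ,  a_i = (id , a_{i-1}) for 2 ≤ i ≤ s-1,
--   a_s = (id , a_{s-1}) σ,  a_i = (a_{i-1} , id) for s+1 ≤ i ≤ r.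
gen : (r s n i : ℕ) → Aut n
gen r s zero    i = leaf
gen r s (suc n) i =
  if i ≡ᵇ 1 then node (gen r s n r) idA true
  else if i <ᵇ s then node idA (gen r s n (i ∸ 1)) false
  else if i ≡ᵇ s then node idA (gen r s n (i ∸ 1)) true
  else node (gen r s n (i ∸ 1)) idA false

-- the generator a_{i+1}|_{T_n} indexed by i : Fin r
a∣ : (r s n : ℕ) → Fin r → Aut n
a∣ r s n i = gen r s n (suc (toℕ i))

-- words in the generators and their inverses (true = inverse)
evalWord : ∀ {r} (s n : ℕ) → List (Fin r × Bool) → Aut n
evalWord {r} s n [] = idA
evalWord {r} s n ((i , false) ∷ w) = a∣ r s n i · evalWord s n w
evalWord {r} s n ((i , true)  ∷ w) = (a∣ r s n i) ⁻¹ · evalWord s n w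

-- G_n = { g|_{T_n} : g ∈ G } = subgroup of Ω_n generated by a_1|_{T_n},…,a_r|_{T_n}
InGn : (r s n : ℕ) → Aut n → Set
InGn r s n x = ∃ λ (w : List (Fin r × Bool)) → evalWord s n w ≡ x

Conj : ∀ {n} → Aut n → Aut n → Set
Conj {n} b a = ∃ λ (g : Aut n) → b ≡ g · a · g ⁻¹

prodFin : ∀ {n r} → (Fin r → Aut n) → Aut n
prodFin {n} {r} f = foldr _·_ idA (map f (allFin r))

{-# OPTIONS --safe #-}
module Submission where

-- Write bᵢ = (cᵢ , dᵢ)τᵢ.  Only b₁ and b_s are active at the root, and every other
-- bᵢ, being conjugate to (a_{i-1} , id) or (id , a_{i-1}), has a trivial section.  After rotating the
-- relation to b₁ · P · b_s · Q = id, its two sections say c₁ P₁ d_s Q₀ = id and d₁ P₀ c_s Q₁ = id,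
-- where P₀, P₁, Q₀, Q₁ are the products of the sections along P and Q.  Factors living on different
-- subtrees commute, so conjugating the right sections by d_s⁻¹ merges the two into a single relation
-- among conjugates of the a_{i-1}|_{T_{n-1}}, to which induction applies.  A solution (φ′ , x′) lifts
-- with φ = (φ′ , d₁ φ′): diagonal elements (g , g), conjugation by a₁ (which swaps the subtrees) and
-- the elements (m , id) of G_n turn the x′ᵢ into elements of G_n; for a_s this needs
-- φ′⁻¹ d₁⁻¹ d_s φ′ ∈ G_{n-1}, which the second section relation provides.

open import Algebra.Bundles using (Group)
import Algebra.Properties.Group
import Algebra.Solver.CommutativeMonoid
open import Data.Bool using (Bool; true; false; not)
import Data.Bool.Properties as Bool
open import Data.Fin using (Fin; zero; suc; _≟_; toℕ; fromℕ; fromℕ<; inject₁; lower₁)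
open import Data.Fin.Permutation
  using (Permutation′; permutation; _⟨$⟩ʳ_; _⟨$⟩ˡ_; inverseˡ; inverseʳ)
import Data.Fin.Properties as Fin
open import Data.List using (List; []; _∷_; _++_; [_]; map; foldr; filter; allFin)
open import Data.List.Membership.Propositional using (_∈_)
open import Data.List.Membership.Propositional.Properties using (∈-allFin; ∈-map⁺; ∈-∃++)
open import Data.List.Properties using (map-∘; map-cong; partition-defn)
open import Data.List.Relation.Binary.Permutation.Propositional
  using (_↭_; ↭-prep; ↭-trans; ↭⇒↭ₛ; ↭ₛ⇒↭)
open import Data.List.Relation.Binary.Permutation.Propositional.Properties
  using (∈-resp-↭; ++-comm; ++⁺; ++-commutativeMonoid)
import Data.List.Relation.Binary.Permutation.Setoid.Properties
open import Data.List.Relation.Unary.All as All using (All; []; _∷_)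
import Data.List.Relation.Unary.All.Properties as Allₚ
open import Data.List.Relation.Unary.AllPairs using (_∷_)
open import Data.List.Relation.Unary.Any using (here; there)
open import Data.List.Relation.Unary.Unique.Propositional using (Unique)
import Data.List.Relation.Unary.Unique.Propositional.Properties as Uniqueₚ
open import Data.Nat using (ℕ; zero; suc; _+_; _<_; _≤_; s≤s; _<ᵇ_; _≡ᵇ_)
import Data.Nat.Properties as ℕ
open import Data.Product using (∃; ∃₂; _×_; _,_; proj₁; proj₂)
open import Data.Sum using (_⊎_; inj₁; inj₂)
open import Data.Vec using (Vec; []; _∷_; lookup)
open import Function using (_∘_)
open import Function.Bundles using (Equivalence)
open import Level using (0ℓ)
open import Relation.Binary.Definitions using (DecidableEquality; tri<; tri≈; tri>)
import Relation.Binary.PropositionalEquality as ≡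
open ≡
  using (_≡_; _≢_; _≗_; refl; sym; ≢-sym; trans; cong; cong₂; subst; module ≡-Reasoning)
open import Relation.Nullary using (¬_; yes; no; contradiction)
open import Relation.Nullary.Decidable using (map′; _×-dec_; decidable-stable)
open import Relation.Unary using (Decidable)
open import Relation.Unary.Properties using (∁?)

-- Free reduction of group words

module FreeGroup where

  infixl 7 _·ᵉ_
  infix 8 _⁻¹ᵉ

  data Expr (k : ℕ) : Set where
    var  : Fin k → Expr k
    idᵉ  : Expr k
    _·ᵉ_ : Expr k → Expr k → Expr k
    _⁻¹ᵉ : Expr k → Expr k

  x₀ : ∀ {k} → Expr (1 + k)
  x₀ = var zero
  x₁ : ∀ {k} → Expr (2 + k)
  x₁ = var (suc zero)
  x₂ : ∀ {k} → Expr (3 + k)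
  x₂ = var (suc (suc zero))
  x₃ : ∀ {k} → Expr (4 + k)
  x₃ = var (suc (suc (suc zero)))
  x₄ : ∀ {k} → Expr (5 + k)
  x₄ = var (suc (suc (suc (suc zero))))
  x₅ : ∀ {k} → Expr (6 + k)
  x₅ = var (suc (suc (suc (suc (suc zero)))))
  x₆ : ∀ {k} → Expr (7 + k)
  x₆ = var (suc (suc (suc (suc (suc (suc zero))))))
  x₇ : ∀ {k} → Expr (8 + k)
  x₇ = var (suc (suc (suc (suc (suc (suc (suc zero)))))))

  -- A letter (i , true) stands for the inverse of the i-th generator.
  Word : ℕ → Set
  Word k = List (Fin k × Bool)

  infixr 5 _◃_ _⋄_

  _◃_ : ∀ {k} → Fin k × Bool → Word k → Word k
  l ◃ [] = [ l ]
  (i , e) ◃ ((j , e′) ∷ w) with i ≟ j | e Bool.≟ not e′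
  ... | yes refl | yes refl = w
  ... | _        | _        = (i , e) ∷ (j , e′) ∷ w

  _⋄_ : ∀ {k} → Word k → Word k → Word k
  [] ⋄ v = v
  (l ∷ w) ⋄ v = l ◃ (w ⋄ v)

  invert : ∀ {k} → Word k → Word k
  invert [] = []
  invert ((i , e) ∷ w) = invert w ⋄ [ i , not e ]

  normalise : ∀ {k} → Expr k → Word k
  normalise (var i) = [ i , false ]
  normalise idᵉ = []
  normalise (e ·ᵉ f) = normalise e ⋄ normalise f
  normalise (e ⁻¹ᵉ) = invert (normalise e)

module GroupSolver {c ℓ} (G : Group c ℓ) where
  open Group G hiding (refl; sym; trans)
  private module ≈ = Group G
  open import Algebra.Properties.Group G
    using (\\-leftDividesˡ; \\-leftDividesʳ; ⁻¹-involutive; ⁻¹-anti-homo-∙; ε⁻¹≈ε)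
  open import Relation.Binary.Reasoning.Setoid setoid
  open FreeGroup

  ⟦_⟧ : ∀ {k} → Expr k → (Fin k → Carrier) → Carrier
  ⟦ var i ⟧ ρ = ρ i
  ⟦ idᵉ ⟧ ρ = ε
  ⟦ e ·ᵉ f ⟧ ρ = ⟦ e ⟧ ρ ∙ ⟦ f ⟧ ρ
  ⟦ e ⁻¹ᵉ ⟧ ρ = ⟦ e ⟧ ρ ⁻¹

  ⟦_⟧ˡ : ∀ {k} → Fin k × Bool → (Fin k → Carrier) → Carrier
  ⟦ i , false ⟧ˡ ρ = ρ i
  ⟦ i , true ⟧ˡ ρ = ρ i ⁻¹

  ⟦_⟧ʷ : ∀ {k} → Word k → (Fin k → Carrier) → Carrier
  ⟦ [] ⟧ʷ ρ = ε
  ⟦ l ∷ w ⟧ʷ ρ = ⟦ l ⟧ˡ ρ ∙ ⟦ w ⟧ʷ ρ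

  module _ {k} (ρ : Fin k → Carrier) where

    ◃-sound : ∀ l w → ⟦ l ◃ w ⟧ʷ ρ ≈ ⟦ l ⟧ˡ ρ ∙ ⟦ w ⟧ʷ ρ
    ◃-sound l [] = ≈.refl
    ◃-sound (i , e) ((j , e′) ∷ w) with i ≟ j | e Bool.≟ not e′
    ◃-sound (i , .true) ((.i , false) ∷ w)  | yes refl | yes refl = ≈.sym (\\-leftDividesʳ (ρ i) _)
    ◃-sound (i , .false) ((.i , true) ∷ w)  | yes refl | yes refl = ≈.sym (\\-leftDividesˡ (ρ i) _)
    ... | yes refl | no _ = ≈.refl
    ... | no _     | _    = ≈.refl

    ⋄-sound : ∀ w v → ⟦ w ⋄ v ⟧ʷ ρ ≈ ⟦ w ⟧ʷ ρ ∙ ⟦ v ⟧ʷ ρ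
    ⋄-sound [] v = ≈.sym (identityˡ _)
    ⋄-sound (l ∷ w) v = begin
      ⟦ l ◃ (w ⋄ v) ⟧ʷ ρ              ≈⟨ ◃-sound l (w ⋄ v) ⟩
      ⟦ l ⟧ˡ ρ ∙ ⟦ w ⋄ v ⟧ʷ ρ         ≈⟨ ∙-congˡ (⋄-sound w v) ⟩
      ⟦ l ⟧ˡ ρ ∙ (⟦ w ⟧ʷ ρ ∙ ⟦ v ⟧ʷ ρ) ≈⟨ ≈.sym (assoc _ _ _) ⟩
      ⟦ l ∷ w ⟧ʷ ρ ∙ ⟦ v ⟧ʷ ρ         ∎

    invert-letter : ∀ i e → ⟦ [ i , not e ] ⟧ʷ ρ ≈ ⟦ i , e ⟧ˡ ρ ⁻¹
    invert-letter i false = identityʳ _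
    invert-letter i true = ≈.trans (identityʳ _) (≈.sym (⁻¹-involutive _))

    invert-sound : ∀ w → ⟦ invert w ⟧ʷ ρ ≈ ⟦ w ⟧ʷ ρ ⁻¹
    invert-sound [] = ≈.sym ε⁻¹≈ε
    invert-sound ((i , e) ∷ w) = begin
      ⟦ invert w ⋄ [ i , not e ] ⟧ʷ ρ          ≈⟨ ⋄-sound (invert w) _ ⟩
      ⟦ invert w ⟧ʷ ρ ∙ ⟦ [ i , not e ] ⟧ʷ ρ   ≈⟨ ∙-cong (invert-sound w) (invert-letter i e) ⟩
      ⟦ w ⟧ʷ ρ ⁻¹ ∙ ⟦ i , e ⟧ˡ ρ ⁻¹             ≈⟨ ≈.sym (⁻¹-anti-homo-∙ _ _) ⟩
      (⟦ i , e ⟧ˡ ρ ∙ ⟦ w ⟧ʷ ρ) ⁻¹             ∎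

    normalise-sound : ∀ e → ⟦ e ⟧ ρ ≈ ⟦ normalise e ⟧ʷ ρ
    normalise-sound (var i) = ≈.sym (identityʳ _)
    normalise-sound idᵉ = ≈.refl
    normalise-sound (e ·ᵉ f) =
      ≈.trans (∙-cong (normalise-sound e) (normalise-sound f)) (≈.sym (⋄-sound (normalise e) _))
    normalise-sound (e ⁻¹ᵉ) =
      ≈.trans (⁻¹-cong (normalise-sound e)) (≈.sym (invert-sound (normalise e)))

  -- Normal forms are freely reduced words, so every identity valid in all groups is proved with refl.
  solve : ∀ {k} (e f : Expr k) → normalise e ≡ normalise f →
          (ρ : Vec Carrier k) → ⟦ e ⟧ (lookup ρ) ≈ ⟦ f ⟧ (lookup ρ)
  solve e f eq ρ = begin
    ⟦ e ⟧ (lookup ρ)                ≈⟨ normalise-sound (lookup ρ) e ⟩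
    ⟦ normalise e ⟧ʷ (lookup ρ)     ≡⟨ cong (λ w → ⟦ w ⟧ʷ (lookup ρ)) eq ⟩
    ⟦ normalise f ⟧ʷ (lookup ρ)     ≈⟨ ≈.sym (normalise-sound (lookup ρ) f) ⟩
    ⟦ f ⟧ (lookup ρ)                ∎

-- Lists enumerating Fin m

module ↭ₛ {A : Set} = Data.List.Relation.Binary.Permutation.Setoid.Properties (≡.setoid A)

filter-partition-↭ : ∀ {A : Set} {p} {P : A → Set p} (P? : Decidable P) xs →
                     xs ↭ filter P? xs ++ filter (∁? P?) xs
filter-partition-↭ P? xs =
  subst (λ (ys , zs) → xs ↭ ys ++ zs) (partition-defn P? xs) (↭ₛ⇒↭ (↭ₛ.partition-↭ P? xs))

IsListing : ∀ {m} → List (Fin m) → Set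
IsListing ℓ = Unique ℓ × (∀ k → k ∈ ℓ)

allFin-listing : ∀ m → IsListing (allFin m)
allFin-listing m = Uniqueₚ.allFin⁺ m , ∈-allFin

map-listing : ∀ {m} (π : Permutation′ m) {ℓ} → IsListing ℓ → IsListing (map (π ⟨$⟩ʳ_) ℓ)
map-listing π (unique , complete) =
  Uniqueₚ.map⁺ (λ eq → trans (sym (inverseˡ π)) (trans (cong (π ⟨$⟩ˡ_) eq) (inverseˡ π))) unique ,
  λ k → subst (_∈ _) (inverseʳ π) (∈-map⁺ (π ⟨$⟩ʳ_) (complete (π ⟨$⟩ˡ k)))

↭-listing : ∀ {m} {ℓ ℓ′ : List (Fin m)} → ℓ ↭ ℓ′ → IsListing ℓ → IsListing ℓ′
↭-listing ℓ↭ℓ′ (unique , complete) =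
  ↭ₛ.Unique-resp-↭ (↭⇒↭ₛ ℓ↭ℓ′) unique , λ k → ∈-resp-↭ ℓ↭ℓ′ (complete k)

Avoids : ∀ {m} → Fin m → Fin m → Fin m → Set
Avoids k k′ j = j ≢ k × j ≢ k′

unique-avoids-middle : ∀ {m} {k : Fin m} P {Q} → Unique (P ++ k ∷ Q) →
                       All (_≢ k) P × All (_≢ k) Q
unique-avoids-middle [] (k∉Q ∷ _) = [] , All.map ≢-sym k∉Q
unique-avoids-middle (j ∷ P) (j∉ ∷ unique) =
  let avoidsP , avoidsQ = unique-avoids-middle P unique
  in All.head (Allₚ.++⁻ʳ P j∉) ∷ avoidsP , avoidsQ

unique-avoids : ∀ {m} {k k′ : Fin m} P {Q} → Unique (k ∷ P ++ k′ ∷ Q) →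
                All (Avoids k k′) P × All (Avoids k k′) Q
unique-avoids P (k∉ ∷ unique) =
  let k∉P , k∉k′Q = Allₚ.++⁻ P k∉
      k′∉P , k′∉Q = unique-avoids-middle P unique
  in All.zip (All.map ≢-sym k∉P , k′∉P) ,
     All.zip (All.map ≢-sym (All.tail k∉k′Q) , k′∉Q)

-- Defs is opened only here: its _⁻¹ would clash with the group field inside GroupSolver.
open import Defs
open ≡-Reasoning
open FreeGroup

-- The group Aut n

node-cong : ∀ {n} {x x′ y y′ : Aut n} {e} → x ≡ x′ → y ≡ y′ → node x y e ≡ node x′ y′ e
node-cong refl refl = refl

·-identityˡ : ∀ {n} (x : Aut n) → idA · x ≡ x
·-identityˡ leaf = refl
·-identityˡ (node x₀ x₁ e) = node-cong (·-identityˡ x₀) (·-identityˡ x₁)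

·-identityʳ : ∀ {n} (x : Aut n) → x · idA ≡ x
·-identityʳ leaf = refl
·-identityʳ (node x₀ x₁ false) = node-cong (·-identityʳ x₀) (·-identityʳ x₁)
·-identityʳ (node x₀ x₁ true) = node-cong (·-identityʳ x₀) (·-identityʳ x₁)

·-assoc : ∀ {n} (x y z : Aut n) → (x · y) · z ≡ x · (y · z)
·-assoc leaf leaf leaf = refl
·-assoc (node x₀ x₁ false) (node y₀ y₁ false) (node z₀ z₁ e) =
  node-cong (·-assoc x₀ y₀ z₀) (·-assoc x₁ y₁ z₁)
·-assoc (node x₀ x₁ false) (node y₀ y₁ true) (node z₀ z₁ e) =
  node-cong (·-assoc x₀ y₀ z₁) (·-assoc x₁ y₁ z₀)
·-assoc (node x₀ x₁ true) (node y₀ y₁ false) (node z₀ z₁ e) =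
  node-cong (·-assoc x₀ y₁ z₁) (·-assoc x₁ y₀ z₀)
·-assoc (node x₀ x₁ true) (node y₀ y₁ true) (node z₀ z₁ false) =
  node-cong (·-assoc x₀ y₁ z₀) (·-assoc x₁ y₀ z₁)
·-assoc (node x₀ x₁ true) (node y₀ y₁ true) (node z₀ z₁ true) =
  node-cong (·-assoc x₀ y₁ z₀) (·-assoc x₁ y₀ z₁)

·-inverseˡ : ∀ {n} (x : Aut n) → x ⁻¹ · x ≡ idA
·-inverseˡ leaf = refl
·-inverseˡ (node x₀ x₁ false) = node-cong (·-inverseˡ x₀) (·-inverseˡ x₁)
·-inverseˡ (node x₀ x₁ true) = node-cong (·-inverseˡ x₁) (·-inverseˡ x₀)

·-inverseʳ : ∀ {n} (x : Aut n) → x · x ⁻¹ ≡ idA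
·-inverseʳ leaf = refl
·-inverseʳ (node x₀ x₁ false) = node-cong (·-inverseʳ x₀) (·-inverseʳ x₁)
·-inverseʳ (node x₀ x₁ true) = node-cong (·-inverseʳ x₀) (·-inverseʳ x₁)

Aut-group : ℕ → Group 0ℓ 0ℓ
Aut-group n = record
  { Carrier = Aut n
  ; _≈_ = _≡_
  ; _∙_ = _·_
  ; ε = idA
  ; _⁻¹ = _⁻¹
  ; isGroup = record
    { isMonoid = record
      { isSemigroup = record
        { isMagma = record { isEquivalence = ≡.isEquivalence ; ∙-cong = cong₂ _·_ }
        ; assoc = ·-assoc
        }
      ; identity = ·-identityˡ , ·-identityʳ
      }
    ; inverse = ·-inverseˡ , ·-inverseʳ
    ; ⁻¹-cong = cong _⁻¹
    }
  }

module AutSolver {n : ℕ} = GroupSolver (Aut-group n)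
module AutProperties {n : ℕ} = Algebra.Properties.Group (Aut-group n)
open AutSolver using (solve; ⟦_⟧ʷ; ⋄-sound; invert-sound)

infixr 7.5 _⊳_

_⊳_ : ∀ {n} → Aut n → Aut n → Aut n
g ⊳ y = g · y · g ⁻¹

⊳-idA : ∀ {n} (g : Aut n) → g ⊳ idA ≡ idA
⊳-idA g = solve (x₀ ·ᵉ idᵉ ·ᵉ x₀ ⁻¹ᵉ) idᵉ refl (g ∷ [])

⊳-· : ∀ {n} (g h y : Aut n) → (g · h) ⊳ y ≡ g ⊳ h ⊳ y
⊳-· g h y =
  solve ((x₀ ·ᵉ x₁) ·ᵉ x₂ ·ᵉ (x₀ ·ᵉ x₁) ⁻¹ᵉ) (x₀ ·ᵉ (x₁ ·ᵉ x₂ ·ᵉ x₁ ⁻¹ᵉ) ·ᵉ x₀ ⁻¹ᵉ) refl (g ∷ h ∷ y ∷ [])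

Aut-zero-trivial : (x : Aut zero) → x ≡ idA
Aut-zero-trivial leaf = refl

infix 4 _≟ᴬ_

_≟ᴬ_ : ∀ {n} → DecidableEquality (Aut n)
leaf ≟ᴬ leaf = yes refl
node x₀ x₁ e ≟ᴬ node y₀ y₁ e′ =
  map′ (λ { (refl , refl , refl) → refl }) (λ { refl → refl , refl , refl })
       (x₀ ≟ᴬ y₀ ×-dec x₁ ≟ᴬ y₁ ×-dec e Bool.≟ e′)

section₀ section₁ : ∀ {n} → Aut (suc n) → Aut n
section₀ (node x₀ _ _) = x₀
section₁ (node _ x₁ _) = x₁

activity : ∀ {n} → Aut (suc n) → Bool
activity (node _ _ e) = e

node-η : ∀ {n} (x : Aut (suc n)) → x ≡ node (section₀ x) (section₁ x) (activity x)
node-η (node _ _ _) = refl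

active-conjugate : ∀ {n} {b : Aut (suc n)} {y z : Aut n} → Conj b (node y z true) →
                   activity b ≡ true × Conj (section₀ b · section₁ b) (y · z)
active-conjugate {y = y} {z} (node g₀ g₁ false , refl) = refl , g₀ ,
  solve ((x₀ ·ᵉ x₁ ·ᵉ x₂ ⁻¹ᵉ) ·ᵉ (x₂ ·ᵉ x₃ ·ᵉ x₀ ⁻¹ᵉ)) (x₀ ·ᵉ (x₁ ·ᵉ x₃) ·ᵉ x₀ ⁻¹ᵉ) refl
        (g₀ ∷ y ∷ g₁ ∷ z ∷ [])
active-conjugate {y = y} {z} (node g₀ g₁ true , refl) = refl , g₀ · z ,
  solve ((x₀ ·ᵉ x₃ ·ᵉ x₂ ⁻¹ᵉ) ·ᵉ (x₂ ·ᵉ x₁ ·ᵉ x₀ ⁻¹ᵉ)) ((x₀ ·ᵉ x₃) ·ᵉ (x₁ ·ᵉ x₃) ·ᵉ (x₀ ·ᵉ x₃) ⁻¹ᵉ) refl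
        (g₀ ∷ y ∷ g₁ ∷ z ∷ [])

active-reconstruction : ∀ {n} {b : Aut (suc n)} {U V y : Aut n} → activity b ≡ true →
                        section₀ b · section₁ b ≡ U ⊳ y → V ≡ section₁ b · U →
                        b ≡ node (U · y · V ⁻¹) (V · idA · U ⁻¹) true
active-reconstruction {b = node c d .true} {U} {V} {y} refl cd≡ refl = node-cong
  (begin
    c                        ≡⟨ solve x₀ ((x₀ ·ᵉ x₁) ·ᵉ x₁ ⁻¹ᵉ) refl (c ∷ d ∷ []) ⟩
    (c · d) · d ⁻¹           ≡⟨ cong (_· d ⁻¹) cd≡ ⟩
    (U ⊳ y) · d ⁻¹           ≡⟨ solve ((x₀ ·ᵉ x₁ ·ᵉ x₀ ⁻¹ᵉ) ·ᵉ x₂ ⁻¹ᵉ) (x₀ ·ᵉ x₁ ·ᵉ (x₂ ·ᵉ x₀) ⁻¹ᵉ) refl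
                                     (U ∷ y ∷ d ∷ []) ⟩
    U · y · (d · U) ⁻¹       ∎)
  (solve x₀ (x₀ ·ᵉ x₁ ·ᵉ idᵉ ·ᵉ x₁ ⁻¹ᵉ) refl (d ∷ U ∷ []))

OneSided : ∀ {n} → Aut (suc n) → Aut n → Set
OneSided b y = activity b ≡ false ×
  (section₁ b ≡ idA × Conj (section₀ b) y ⊎ section₀ b ≡ idA × Conj (section₁ b) y)

left-conjugate-one-sided : ∀ {n} {b : Aut (suc n)} {y : Aut n} →
                           Conj b (node y idA false) → OneSided b y
left-conjugate-one-sided (node g₀ g₁ false , refl) = refl , inj₁ (⊳-idA g₁ , g₀ , refl)
left-conjugate-one-sided (node g₀ g₁ true , refl) = refl , inj₂ (⊳-idA g₀ , g₁ , refl)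

right-conjugate-one-sided : ∀ {n} {b : Aut (suc n)} {y : Aut n} →
                            Conj b (node idA y false) → OneSided b y
right-conjugate-one-sided (node g₀ g₁ false , refl) = refl , inj₂ (⊳-idA g₀ , g₁ , refl)
right-conjugate-one-sided (node g₀ g₁ true , refl) = refl , inj₁ (⊳-idA g₁ , g₀ , refl)

Δ : ∀ {n} → Aut n → Aut (suc n)
Δ y = node y y false

Δ-⊳-left : ∀ {n} (u y : Aut n) → Δ u ⊳ node y idA false ≡ node (u ⊳ y) idA false
Δ-⊳-left u y = cong (λ t → node (u ⊳ y) t false) (⊳-idA u)

swap-to-right : ∀ {n} (A y : Aut n) → node A idA true ⊳ node y idA false ≡ node idA y false
swap-to-right A y = node-cong
  (solve ((x₀ ·ᵉ idᵉ) ·ᵉ x₀ ⁻¹ᵉ) idᵉ refl (A ∷ []))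
  (solve ((idᵉ ·ᵉ x₀) ·ᵉ idᵉ ⁻¹ᵉ) x₀ refl (y ∷ []))

swap-to-left : ∀ {n} (A y : Aut n) → (node A idA true) ⁻¹ ⊳ node idA y false ≡ node y idA false
swap-to-left A y = node-cong
  (solve ((idᵉ ⁻¹ᵉ ·ᵉ x₀) ·ᵉ idᵉ ⁻¹ᵉ ⁻¹ᵉ) x₀ refl (y ∷ []))
  (solve ((x₀ ⁻¹ᵉ ·ᵉ idᵉ) ·ᵉ x₀ ⁻¹ᵉ ⁻¹ᵉ) idᵉ refl (A ∷ []))

prod : ∀ {n} {A : Set} → (A → Aut n) → List A → Aut n
prod f xs = foldr _·_ idA (map f xs)

module _ {n : ℕ} {A : Set} where

  prod-++ : ∀ (f : A → Aut n) xs ys → prod f (xs ++ ys) ≡ prod f xs · prod f ys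
  prod-++ f [] ys = sym (·-identityˡ _)
  prod-++ f (x ∷ xs) ys = trans (cong (f x ·_) (prod-++ f xs ys)) (sym (·-assoc _ _ _))

  prod-map : ∀ {B : Set} (f : A → Aut n) (g : B → A) xs → prod f (map g xs) ≡ prod (f ∘ g) xs
  prod-map f g xs = cong (foldr _·_ idA) (sym (map-∘ xs))

  prod-cong : ∀ {f g : A → Aut n} → f ≗ g → ∀ xs → prod f xs ≡ prod g xs
  prod-cong f≗g xs = cong (foldr _·_ idA) (map-cong f≗g xs)

  prod-⊳ : ∀ (h : Aut n) (f : A → Aut n) xs → prod (λ x → h ⊳ f x) xs ≡ h ⊳ prod f xs
  prod-⊳ h f [] = sym (⊳-idA h)
  prod-⊳ h f (x ∷ xs) = begin
    h ⊳ f x · prod (λ x → h ⊳ f x) xs   ≡⟨ cong (h ⊳ f x ·_) (prod-⊳ h f xs) ⟩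
    h ⊳ f x · h ⊳ prod f xs             ≡⟨ solve ((x₀ ·ᵉ x₁ ·ᵉ x₀ ⁻¹ᵉ) ·ᵉ (x₀ ·ᵉ x₂ ·ᵉ x₀ ⁻¹ᵉ))
                                                   (x₀ ·ᵉ (x₁ ·ᵉ x₂) ·ᵉ x₀ ⁻¹ᵉ) refl (h ∷ f x ∷ prod f xs ∷ []) ⟩
    h ⊳ (f x · prod f xs)               ∎

  prod-rotate : ∀ (f : A → Aut n) xs ys → prod f (xs ++ ys) ≡ idA → prod f (ys ++ xs) ≡ idA
  prod-rotate f xs ys rel = begin
    prod f (ys ++ xs)             ≡⟨ prod-++ f ys xs ⟩
    prod f ys · prod f xs         ≡⟨ cong (_· prod f xs) ys≡xs⁻¹ ⟩
    prod f xs ⁻¹ · prod f xs      ≡⟨ ·-inverseˡ _ ⟩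
    idA                           ∎
    where
    ys≡xs⁻¹ : prod f ys ≡ prod f xs ⁻¹
    ys≡xs⁻¹ = AutProperties.inverseʳ-unique _ _ (trans (sym (prod-++ f xs ys)) rel)

  prod-filter : ∀ {p} {P : A → Set p} (P? : Decidable P) (f g : A → Aut n) {xs} →
                All (λ x → (P x → f x ≡ g x) × (¬ P x → g x ≡ idA)) xs →
                prod f (filter P? xs) ≡ prod g xs
  prod-filter P? f g [] = refl
  prod-filter P? f g {x ∷ xs} ((agree , trivial) ∷ hs) with P? x
  ... | yes px = cong₂ _·_ (agree px) (prod-filter P? f g hs)
  ... | no ¬px =
    trans (prod-filter P? f g hs) (sym (trans (cong (_· prod g xs) (trivial ¬px)) (·-identityˡ _)))

prod-inactive : ∀ {n} {A : Set} (f : A → Aut (suc n)) {xs} → All (λ x → activity (f x) ≡ false) xs →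
                prod f xs ≡ node (prod (section₀ ∘ f) xs) (prod (section₁ ∘ f) xs) false
prod-inactive f [] = refl
prod-inactive f {x ∷ xs} (inactive ∷ hs) =
  trans (cong₂ _·_ (node-η (f x)) (prod-inactive f hs)) (multiply (activity (f x)) inactive)
  where
  multiply : ∀ e → e ≡ false →
             node (section₀ (f x)) (section₁ (f x)) e ·
               node (prod (section₀ ∘ f) xs) (prod (section₁ ∘ f) xs) false
             ≡ node (prod (section₀ ∘ f) (x ∷ xs)) (prod (section₁ ∘ f) (x ∷ xs)) false
  multiply .false refl = refl

cyclic-normal-form : ∀ {n m} (f : Fin m → Aut n) {k k′ : Fin m} {ℓ} → k′ ≢ k →
  IsListing ℓ → prod f ℓ ≡ idA →
  ∃₂ λ P Q → IsListing (k ∷ P ++ k′ ∷ Q) × prod f (k ∷ P ++ k′ ∷ Q) ≡ idA ×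
             All (Avoids k k′) P × All (Avoids k k′) Q
cyclic-normal-form f {k} {k′} k′≢k listing rel
  with A , B , refl ← ∈-∃++ (proj₂ listing k)
  with proj₂ (↭-listing (++-comm A (k ∷ B)) listing) k′
... | here k′≡k = contradiction k′≡k k′≢k
... | there k′∈BA with P , Q , BA≡ ← ∈-∃++ k′∈BA =
  P , Q , listing′ , rel′ , unique-avoids P (proj₁ listing′)
  where
  listing′ : IsListing (k ∷ P ++ k′ ∷ Q)
  listing′ = subst (IsListing ∘ (k ∷_)) BA≡ (↭-listing (++-comm A (k ∷ B)) listing)
  rel′ : prod f (k ∷ P ++ k′ ∷ Q) ≡ idA
  rel′ = subst (λ ℓ → prod f (k ∷ ℓ) ≡ idA) BA≡ (prod-rotate f A (k ∷ B) rel)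

-- The generators and the groups G_n

<ᵇ-true : ∀ {m n} → m < n → (m <ᵇ n) ≡ true
<ᵇ-true m<n = Equivalence.to Bool.T-≡ (ℕ.<⇒<ᵇ m<n)

<ᵇ-false : ∀ {m n} → n ≤ m → (m <ᵇ n) ≡ false
<ᵇ-false {m} {n} n≤m =
  Bool.¬-not λ eq → ℕ.≤⇒≯ n≤m (ℕ.<ᵇ⇒< m n (Equivalence.from Bool.T-≡ eq))

≡ᵇ-false : ∀ {m n} → m ≢ n → (m ≡ᵇ n) ≡ false
≡ᵇ-false {m} {n} m≢n =
  Bool.¬-not λ eq → m≢n (ℕ.≡ᵇ⇒≡ m n (Equivalence.from Bool.T-≡ eq))

gen-below : ∀ r s n t → 2 + t < s → gen r s (suc n) (2 + t) ≡ node idA (gen r s n (1 + t)) false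
gen-below r s n t lt rewrite <ᵇ-true lt = refl

gen-at : ∀ r n t → gen r (2 + t) (suc n) (2 + t) ≡ node idA (gen r (2 + t) n (1 + t)) true
gen-at r n t
  rewrite <ᵇ-false (ℕ.≤-refl {2 + t}) | Equivalence.to Bool.T-≡ (ℕ.≡⇒≡ᵇ t t refl) = refl

gen-above : ∀ r s n t → s < 2 + t → gen r s (suc n) (2 + t) ≡ node (gen r s n (1 + t)) idA false
gen-above r s n t gt rewrite <ᵇ-false (ℕ.<⇒≤ gt) | ≡ᵇ-false (ℕ.>⇒≢ gt) = refl

module _ {r s n : ℕ} where

  private
    G : Aut n → Set
    G = InGn r s n

  evalWord-sound : ∀ w → evalWord s n w ≡ ⟦ w ⟧ʷ (a∣ r s n)
  evalWord-sound [] = refl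
  evalWord-sound ((i , false) ∷ w) = cong (a∣ r s n i ·_) (evalWord-sound w)
  evalWord-sound ((i , true) ∷ w) = cong (a∣ r s n i ⁻¹ ·_) (evalWord-sound w)

  InGn-idA : G idA
  InGn-idA = [] , refl

  InGn-gen : ∀ i → G (a∣ r s n i)
  InGn-gen i = [ i , false ] , ·-identityʳ _

  InGn-· : ∀ {x y} → G x → G y → G (x · y)
  InGn-· (w , refl) (v , refl) = w ⋄ v , (begin
    evalWord s n (w ⋄ v)               ≡⟨ evalWord-sound (w ⋄ v) ⟩
    ⟦ w ⋄ v ⟧ʷ (a∣ r s n)              ≡⟨ ⋄-sound (a∣ r s n) w v ⟩
    ⟦ w ⟧ʷ (a∣ r s n) · ⟦ v ⟧ʷ (a∣ r s n) ≡⟨ sym (cong₂ _·_ (evalWord-sound w) (evalWord-sound v)) ⟩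
    evalWord s n w · evalWord s n v    ∎)

  InGn-⁻¹ : ∀ {x} → G x → G (x ⁻¹)
  InGn-⁻¹ (w , refl) = invert w , (begin
    evalWord s n (invert w)   ≡⟨ evalWord-sound (invert w) ⟩
    ⟦ invert w ⟧ʷ (a∣ r s n)  ≡⟨ invert-sound (a∣ r s n) w ⟩
    ⟦ w ⟧ʷ (a∣ r s n) ⁻¹      ≡⟨ cong _⁻¹ (sym (evalWord-sound w)) ⟩
    evalWord s n w ⁻¹         ∎)

  InGn-⊳ : ∀ {g y} → G g → G y → G (g ⊳ y)
  InGn-⊳ g∈ y∈ = InGn-· (InGn-· g∈ y∈) (InGn-⁻¹ g∈)

-- The index j : Fin r stands for a_{j+1}: s′ is the index of a_s, and prev j that of the nontrivial
-- section of a_{j+1}.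
module Generators (r′ s : ℕ) (s′ : Fin (suc r′)) (s≡ : suc (toℕ s′) ≡ s) (s′≢0 : s′ ≢ zero) where

  r : ℕ
  r = suc r′

  a : ∀ n → Fin r → Aut n
  a = a∣ r s

  prev next : Fin r → Fin r
  prev zero = fromℕ r′
  prev (suc j) = inject₁ j

  next k with k ≟ fromℕ r′
  ... | yes _ = zero
  ... | no k≢last =
    suc (lower₁ k (λ r′≡k → k≢last (Fin.toℕ-injective (trans (sym r′≡k) (sym (Fin.toℕ-fromℕ r′))))))

  prev-next : ∀ k → prev (next k) ≡ k
  prev-next k with k ≟ fromℕ r′
  ... | yes k≡last = sym k≡last
  ... | no _ = Fin.inject₁-lower₁ k _

  next-prev : ∀ j → next (prev j) ≡ j
  next-prev zero with fromℕ r′ ≟ fromℕ r′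
  ... | yes _ = refl
  ... | no last≢last = contradiction refl last≢last
  next-prev (suc j) with inject₁ j ≟ fromℕ r′
  ... | yes j≡last = contradiction (sym j≡last) Fin.fromℕ≢inject₁
  ... | no _ = cong suc (Fin.lower₁-inject₁′ j _)

  cycle : Permutation′ r
  cycle = permutation prev next prev-next next-prev

  Passive : Fin r → Set
  Passive = Avoids zero s′

  a-zero : ∀ n → a (suc n) zero ≡ node (a n (prev zero)) idA true
  a-zero n = cong (λ t → node (gen r s n (suc t)) idA true) (sym (Fin.toℕ-fromℕ r′))

  a-prev-suc : ∀ n j → gen r s n (1 + toℕ j) ≡ a n (prev (suc j))
  a-prev-suc n j = cong (λ t → gen r s n (suc t)) (sym (Fin.toℕ-inject₁ j))

  a-s′ : ∀ n → a (suc n) s′ ≡ node idA (a n (prev s′)) true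
  a-s′ n = a-at s′ s≡ s′≢0
    where
    a-at : ∀ k → suc (toℕ k) ≡ s → k ≢ zero → a (suc n) k ≡ node idA (a n (prev k)) true
    a-at zero _ k≢0 = contradiction refl k≢0
    a-at (suc j) k≡ _ =
      trans (subst (λ s → gen r s (suc n) (2 + toℕ j) ≡ node idA (gen r s n (1 + toℕ j)) true)
                   k≡ (gen-at r n (toℕ j)))
            (cong (λ y → node idA y true) (a-prev-suc n j))

  a-passive : ∀ n {j} → Passive j →
              a (suc n) j ≡ node (a n (prev j)) idA false ⊎
              a (suc n) j ≡ node idA (a n (prev j)) false
  a-passive n {zero} (j≢0 , _) = contradiction refl j≢0
  a-passive n {suc j} (_ , j≢s′) with ℕ.<-cmp (suc (toℕ j)) (toℕ s′)
  ... | tri< lt _ _ = inj₂ (trans (gen-below r s n (toℕ j) (subst (2 + toℕ j <_) s≡ (s≤s lt)))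
                                  (cong (λ y → node idA y false) (a-prev-suc n j)))
  ... | tri≈ _ eq _ = contradiction (Fin.toℕ-injective eq) j≢s′
  ... | tri> _ _ gt = inj₁ (trans (gen-above r s n (toℕ j) (subst (_< 2 + toℕ j) s≡ (s≤s gt)))
                                  (cong (λ y → node y idA false) (a-prev-suc n j)))

  G : ∀ n → Aut n → Set
  G = InGn r s

  GConj : ∀ n → Aut n → Aut n → Set
  GConj n z y = ∃ λ x → G n x × z ≡ x ⊳ y

  GConj-member : ∀ {n z y} → GConj n z y → G n y → G n z
  GConj-member (x , x∈ , refl) y∈ = InGn-⊳ x∈ y∈

  GConj-⊳ : ∀ {n g z y} → G n g → GConj n z y → GConj n (g ⊳ z) y
  GConj-⊳ {g = g} g∈ (x , x∈ , refl) = g · x , InGn-· g∈ x∈ , sym (⊳-· g x _)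

  a₀∈ : ∀ n → G (suc n) (node (a n (prev zero)) idA true)
  a₀∈ n = subst (G (suc n)) (a-zero n) (InGn-gen zero)

  aₛ∈ : ∀ n → G (suc n) (node idA (a n (prev s′)) true)
  aₛ∈ n = subst (G (suc n)) (a-s′ n) (InGn-gen s′)

  passive-left : ∀ n {j} → Passive j → GConj (suc n) (node (a n (prev j)) idA false) (a (suc n) j)
  passive-left n p with a-passive n p
  ... | inj₁ a≡ = idA , InGn-idA , sym (trans (solve (idᵉ ·ᵉ x₀ ·ᵉ idᵉ ⁻¹ᵉ) x₀ refl (_ ∷ [])) a≡)
  ... | inj₂ a≡ = a₀ ⁻¹ , InGn-⁻¹ (a₀∈ n) , sym (trans (cong (a₀ ⁻¹ ⊳_) a≡) (swap-to-left _ _))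
    where a₀ = node (a n (prev zero)) idA true

  passive-right : ∀ n {j} → Passive j → GConj (suc n) (node idA (a n (prev j)) false) (a (suc n) j)
  passive-right n p with a-passive n p
  ... | inj₁ a≡ = a₀ , a₀∈ n , sym (trans (cong (a₀ ⊳_) a≡) (swap-to-right _ _))
    where a₀ = node (a n (prev zero)) idA true
  ... | inj₂ a≡ = idA , InGn-idA , sym (trans (solve (idᵉ ·ᵉ x₀ ·ᵉ idᵉ ⁻¹ᵉ) x₀ refl (_ ∷ [])) a≡)

  diagonal-a∈ : ∀ n j → G (suc n) (Δ (a n (prev j)))
  diagonal-a∈ n j with j ≟ zero | j ≟ s′
  ... | yes refl | _ = subst (G (suc n)) (node-cong (·-identityʳ _) (·-identityˡ _))
                             (InGn-· (a₀∈ n) (a₀∈ n))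
  ... | no _ | yes refl = subst (G (suc n)) (node-cong (·-identityˡ _) (·-identityʳ _))
                                (InGn-· (aₛ∈ n) (aₛ∈ n))
  ... | no j≢0 | no j≢s′ = subst (G (suc n)) (node-cong (·-identityʳ _) (·-identityˡ _))
                                 (InGn-· (GConj-member (passive-left n p) (InGn-gen j))
                                         (GConj-member (passive-right n p) (InGn-gen j)))
    where p = j≢0 , j≢s′

  diagonal∈ : ∀ n {y} → G n y → G (suc n) (Δ y)
  diagonal∈ n (w , refl) = word w
    where
    generator : ∀ k → G (suc n) (Δ (a n k))
    generator k = subst (λ k → G (suc n) (Δ (a n k))) (prev-next k) (diagonal-a∈ n (next k))
    word : ∀ w → G (suc n) (Δ (evalWord s n w))
    word [] = InGn-idA
    word ((i , false) ∷ w) = InGn-· (generator i) (word w)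
    word ((i , true) ∷ w) = InGn-· (InGn-⁻¹ (generator i)) (word w)

  one-sided-left : ∀ n {j u} → Passive j → G n u →
                   GConj (suc n) (node (u ⊳ a n (prev j)) idA false) (a (suc n) j)
  one-sided-left n {j} {u} p u∈ =
    subst (λ z → GConj (suc n) z (a (suc n) j)) (Δ-⊳-left u (a n (prev j)))
          (GConj-⊳ (diagonal∈ n u∈) (passive-left n p))

  one-sided-right : ∀ n {j u} → Passive j → G n u →
                    GConj (suc n) (node idA (u ⊳ a n (prev j)) false) (a (suc n) j)
  one-sided-right n {j} {u} p u∈ =
    subst (λ z → GConj (suc n) z (a (suc n) j)) (node-cong (⊳-idA u) refl)
          (GConj-⊳ (diagonal∈ n u∈) (passive-right n p))

  -- (m , id) ∈ G_{n+1}: m is the section at 0 of an element of the rigid stabiliser of the vertex 0.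
  Rist : ∀ n → Aut n → Set
  Rist n m = G (suc n) (node m idA false)

  Rist-idA : ∀ n → Rist n idA
  Rist-idA n = InGn-idA

  Rist-· : ∀ n {m m′} → Rist n m → Rist n m′ → Rist n (m · m′)
  Rist-· n m∈ m′∈ = subst (G (suc n)) (node-cong refl (·-identityˡ idA)) (InGn-· m∈ m′∈)

  Rist-⁻¹ : ∀ n {m} → Rist n m → Rist n (m ⁻¹)
  Rist-⁻¹ n m∈ = subst (G (suc n)) (node-cong refl AutProperties.ε⁻¹≈ε) (InGn-⁻¹ m∈)

  Rist-⊳ : ∀ n {g m} → G n g → Rist n m → Rist n (g ⊳ m)
  Rist-⊳ n {g} g∈ m∈ =
    subst (G (suc n)) (node-cong refl (⊳-idA g)) (InGn-⊳ (diagonal∈ n g∈) m∈)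

  Rist-a : ∀ n {j} → Passive j → Rist n (a n (prev j))
  Rist-a n {j} p = GConj-member (passive-left n p) (InGn-gen j)

  active-lift : ∀ n {t₀ t₁} → G n t₁ → Rist n (t₀ · a n (prev s′) · t₁ ⁻¹) →
                G (suc n) (node t₀ t₁ true)
  active-lift n {t₀} {t₁} t₁∈ m∈ =
    subst (G (suc n))
      (node-cong (solve (((x₀ ·ᵉ x₁ ·ᵉ x₂ ⁻¹ᵉ) ·ᵉ (x₂ ·ᵉ x₁ ⁻¹ᵉ)) ·ᵉ idᵉ) x₀ refl (t₀ ∷ B ∷ t₁ ∷ []))
                 (solve ((idᵉ ·ᵉ (x₀ ·ᵉ x₁ ⁻¹ᵉ)) ·ᵉ x₁) x₀ refl (t₁ ∷ B ∷ [])))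
      (InGn-· (InGn-· m∈ (diagonal∈ n (InGn-· t₁∈ (InGn-⁻¹ (InGn-gen (prev s′)))))) (aₛ∈ n))
    where B = a n (prev s′)

  -- Lifting solutions from level n to level n + 1

  Solution : ∀ n → (Fin r → Aut n) → Set
  Solution n b = ∃ λ (φ : Aut n) → ∃ λ (x : Fin r → Aut n) →
    (∀ i → G n (x i)) × (∀ i → b i ≡ (φ · x i) ⊳ a n i)

  module Descent (n : ℕ) (b : Fin r → Aut (suc n)) (b∼a : ∀ i → Conj (b i) (a (suc n) i))
                 (P Q : List (Fin r)) (P-passive : All Passive P) (Q-passive : All Passive Q)
                 (listing : IsListing (zero ∷ P ++ s′ ∷ Q))
                 (rel : prod b (zero ∷ P ++ s′ ∷ Q) ≡ idA) where

    c d : Fin r → Aut n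
    c j = section₀ (b j)
    d j = section₁ (b j)

    δ : Aut n
    δ = d s′

    -- Conjugating right sections by δ⁻¹ (as if moved next to b s′) is what merges the two section
    -- relations into the single β̂-relation one level down.
    β̂ : Fin r → Aut n
    β̂ j with j ≟ zero
    ... | yes _ = c j · d j
    ... | no _ = c j · δ ⁻¹ ⊳ d j

    β̂-nonzero : ∀ {j} → j ≢ zero → β̂ j ≡ c j · δ ⁻¹ ⊳ d j
    β̂-nonzero {j} j≢0 with j ≟ zero
    ... | yes j≡0 = contradiction j≡0 j≢0
    ... | no _ = refl

    δ⁻¹⊳δ : δ ⁻¹ ⊳ δ ≡ δ
    δ⁻¹⊳δ = solve (x₀ ⁻¹ᵉ ·ᵉ x₀ ·ᵉ x₀ ⁻¹ᵉ ⁻¹ᵉ) x₀ refl (δ ∷ [])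

    β̂-s′ : β̂ s′ ≡ c s′ · δ
    β̂-s′ = trans (β̂-nonzero s′≢0) (cong (c s′ ·_) δ⁻¹⊳δ)

    active-zero : activity (b zero) ≡ true × Conj (c zero · d zero) (a n (prev zero) · idA)
    active-zero = active-conjugate (subst (Conj (b zero)) (a-zero n) (b∼a zero))

    active-s′ : activity (b s′) ≡ true × Conj (c s′ · d s′) (idA · a n (prev s′))
    active-s′ = active-conjugate (subst (Conj (b s′)) (a-s′ n) (b∼a s′))

    passive-one-sided : ∀ {j} → Passive j → OneSided (b j) (a n (prev j))
    passive-one-sided {j} p with a-passive n p
    ... | inj₁ a≡ = left-conjugate-one-sided (subst (Conj (b j)) a≡ (b∼a j))
    ... | inj₂ a≡ = right-conjugate-one-sided (subst (Conj (b j)) a≡ (b∼a j))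

    passive-β̂∼ : ∀ {j} → Passive j → Conj (c j · δ ⁻¹ ⊳ d j) (a n (prev j))
    passive-β̂∼ {j} p with proj₂ (passive-one-sided p)
    ... | inj₁ (d≡idA , h , c≡) = h , (begin
      c j · δ ⁻¹ ⊳ d j      ≡⟨ cong (λ t → c j · δ ⁻¹ ⊳ t) d≡idA ⟩
      c j · δ ⁻¹ ⊳ idA      ≡⟨ trans (cong (c j ·_) (⊳-idA (δ ⁻¹))) (·-identityʳ (c j)) ⟩
      c j                   ≡⟨ c≡ ⟩
      h ⊳ a n (prev j)      ∎)
    ... | inj₂ (c≡idA , h , d≡) = δ ⁻¹ · h , (begin
      c j · δ ⁻¹ ⊳ d j              ≡⟨ cong₂ (λ u v → u · δ ⁻¹ ⊳ v) c≡idA d≡ ⟩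
      idA · δ ⁻¹ ⊳ h ⊳ a n (prev j)  ≡⟨ trans (·-identityˡ _) (sym (⊳-· (δ ⁻¹) h _)) ⟩
      (δ ⁻¹ · h) ⊳ a n (prev j)     ∎)

    β̂∼ : ∀ j → Conj (β̂ j) (a n (prev j))
    β̂∼ j with j ≟ zero | j ≟ s′
    ... | yes refl | _ =
      let h , eq = proj₂ active-zero in h , trans eq (cong (h ⊳_) (·-identityʳ _))
    ... | no _ | yes refl =
      let h , eq = proj₂ active-s′
      in h , trans (cong (c s′ ·_) δ⁻¹⊳δ) (trans eq (cong (h ⊳_) (·-identityˡ _)))
    ... | no j≢0 | no j≢s′ = passive-β̂∼ (j≢0 , j≢s′)

    β : Fin r → Aut n
    β k = β̂ (next k)

    β∼ : ∀ k → Conj (β k) (a n k)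
    β∼ k = subst (λ k′ → Conj (β k) (a n k′)) (prev-next k) (β̂∼ (next k))

    p₀ p₁ q₀ q₁ : Aut n
    p₀ = prod c P
    p₁ = prod d P
    q₀ = prod c Q
    q₁ = prod d Q

    inactive : ∀ {X} → All Passive X → All (λ j → activity (b j) ≡ false) X
    inactive = All.map (λ p → proj₁ (passive-one-sided p))

    section-relations : c zero · (p₁ · (δ · q₀)) ≡ idA × d zero · (p₀ · (c s′ · q₁)) ≡ idA
    section-relations = cong section₀ node-relation , cong section₁ node-relation
      where
      active≡ : ∀ j → activity (b j) ≡ true → b j ≡ node (c j) (d j) true
      active≡ j act = trans (node-η (b j)) (cong (node (c j) (d j)) act)
      node-relation : node (c zero · (p₁ · (δ · q₀))) (d zero · (p₀ · (c s′ · q₁))) false ≡ idA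
      node-relation = begin
        node (c zero) (d zero) true · (node p₀ p₁ false · (node (c s′) δ true · node q₀ q₁ false))
          ≡⟨ sym (cong₂ _·_ (active≡ zero (proj₁ active-zero))
                   (cong₂ _·_ (prod-inactive b (inactive P-passive))
                     (cong₂ _·_ (active≡ s′ (proj₁ active-s′)) (prod-inactive b (inactive Q-passive))))) ⟩
        b zero · (prod b P · (b s′ · prod b Q))
          ≡⟨ cong (b zero ·_) (sym (prod-++ b P (s′ ∷ Q))) ⟩
        prod b (zero ∷ P ++ s′ ∷ Q)
          ≡⟨ rel ⟩
        idA ∎

    LeftSupported? : Decidable (λ j → d j ≡ idA)
    LeftSupported? j = d j ≟ᴬ idA

    right-supported : ∀ {j} → Passive j → d j ≢ idA → c j ≡ idA
    right-supported p d≢idA with proj₂ (passive-one-sided p)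
    ... | inj₁ (d≡idA , _) = contradiction d≡idA d≢idA
    ... | inj₂ (c≡idA , _) = c≡idA

    β̂-left : ∀ {j} → Passive j → d j ≡ idA → β̂ j ≡ c j
    β̂-left {j} p d≡idA = begin
      β̂ j                   ≡⟨ β̂-nonzero (proj₁ p) ⟩
      c j · δ ⁻¹ ⊳ d j      ≡⟨ cong (λ t → c j · δ ⁻¹ ⊳ t) d≡idA ⟩
      c j · δ ⁻¹ ⊳ idA      ≡⟨ trans (cong (c j ·_) (⊳-idA (δ ⁻¹))) (·-identityʳ (c j)) ⟩
      c j                   ∎

    β̂-right : ∀ {j} → Passive j → d j ≢ idA → β̂ j ≡ δ ⁻¹ ⊳ d j
    β̂-right {j} p d≢idA =
      trans (β̂-nonzero (proj₁ p))
            (trans (cong (_· δ ⁻¹ ⊳ d j) (right-supported p d≢idA)) (·-identityˡ _))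

    prod-left : ∀ {X} → All Passive X → prod β̂ (filter LeftSupported? X) ≡ prod c X
    prod-left ps = prod-filter LeftSupported? β̂ c (All.map (λ p → β̂-left p , right-supported p) ps)

    prod-right : ∀ {X} → All Passive X → prod β̂ (filter (∁? LeftSupported?) X) ≡ δ ⁻¹ ⊳ prod d X
    prod-right {X} ps =
      trans (prod-filter (∁? LeftSupported?) β̂ (λ j → δ ⁻¹ ⊳ d j)
                         (All.map (λ p → β̂-right p , trivial) ps))
            (prod-⊳ (δ ⁻¹) d X)
      where
      trivial : ∀ {j} → ¬ ¬ d j ≡ idA → δ ⁻¹ ⊳ d j ≡ idA
      trivial {j} ¬¬d≡idA =
        trans (cong (δ ⁻¹ ⊳_) (decidable-stable (LeftSupported? j) ¬¬d≡idA)) (⊳-idA (δ ⁻¹))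

    left-part : ∀ {j} → Passive j → c j ≡ idA ⊎ c j ≡ β̂ j
    left-part {j} p with LeftSupported? j
    ... | yes d≡idA = inj₂ (sym (β̂-left p d≡idA))
    ... | no d≢idA = inj₁ (right-supported p d≢idA)

    right-part : ∀ {j} → Passive j → δ ⁻¹ ⊳ d j ≡ idA ⊎ δ ⁻¹ ⊳ d j ≡ β̂ j
    right-part {j} p with LeftSupported? j
    ... | yes d≡idA = inj₁ (trans (cong (δ ⁻¹ ⊳_) d≡idA) (⊳-idA (δ ⁻¹)))
    ... | no d≢idA = inj₂ (sym (β̂-right p d≢idA))

    F₁ F₂ F₃ F₄ : List (Fin r)
    F₁ = filter LeftSupported? P
    F₂ = filter (∁? LeftSupported?) Q
    F₃ = filter (∁? LeftSupported?) P
    F₄ = filter LeftSupported? Q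

    ℓ̂ : List (Fin r)
    ℓ̂ = zero ∷ F₁ ++ s′ ∷ F₂ ++ F₃ ++ F₄

    β̂-relation : prod β̂ ℓ̂ ≡ idA
    β̂-relation = begin
      prod β̂ ℓ̂
        ≡⟨ cong (β̂ zero ·_) (trans (prod-++ β̂ F₁ _) (cong (λ t → prod β̂ F₁ · (β̂ s′ · t))
             (trans (prod-++ β̂ F₂ _) (cong (prod β̂ F₂ ·_) (prod-++ β̂ F₃ F₄))))) ⟩
      β̂ zero · (prod β̂ F₁ · (β̂ s′ · (prod β̂ F₂ · (prod β̂ F₃ · prod β̂ F₄))))
        ≡⟨ cong₂ _·_ refl (cong₂ _·_ (prod-left P-passive) (cong₂ _·_ β̂-s′
             (cong₂ _·_ (prod-right Q-passive) (cong₂ _·_ (prod-right P-passive) (prod-left Q-passive))))) ⟩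
      (c zero · d zero) · (p₀ · ((c s′ · δ) · (δ ⁻¹ ⊳ q₁ · (δ ⁻¹ ⊳ p₁ · q₀))))
        ≡⟨ solve ((x₀ ·ᵉ x₁) ·ᵉ (x₂ ·ᵉ ((x₃ ·ᵉ x₄) ·ᵉ
                   ((x₄ ⁻¹ᵉ ·ᵉ x₅ ·ᵉ x₄ ⁻¹ᵉ ⁻¹ᵉ) ·ᵉ ((x₄ ⁻¹ᵉ ·ᵉ x₆ ·ᵉ x₄ ⁻¹ᵉ ⁻¹ᵉ) ·ᵉ x₇)))))
                 (x₀ ·ᵉ ((x₁ ·ᵉ (x₂ ·ᵉ (x₃ ·ᵉ x₅))) ·ᵉ (x₆ ·ᵉ (x₄ ·ᵉ x₇)))) refl
                 (c zero ∷ d zero ∷ p₀ ∷ c s′ ∷ δ ∷ q₁ ∷ p₁ ∷ q₀ ∷ []) ⟩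
      c zero · ((d zero · (p₀ · (c s′ · q₁))) · (p₁ · (δ · q₀)))
        ≡⟨ cong (λ t → c zero · (t · (p₁ · (δ · q₀)))) (proj₂ section-relations) ⟩
      c zero · (idA · (p₁ · (δ · q₀)))   ≡⟨ cong (c zero ·_) (·-identityˡ _) ⟩
      c zero · (p₁ · (δ · q₀))           ≡⟨ proj₁ section-relations ⟩
      idA                                ∎

    β-relation : prod β (map prev ℓ̂) ≡ idA
    β-relation = trans (prod-map β prev ℓ̂) (trans (prod-cong (cong β̂ ∘ next-prev) ℓ̂) β̂-relation)

    β-listing : IsListing (map prev ℓ̂)
    β-listing = map-listing cycle (↭-listing (↭-prep zero rearranged) listing)
      where
      module ++-Solver = Algebra.Solver.CommutativeMonoid (++-commutativeMonoid {A = Fin r})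
      open ++-Solver using (var; _⊕_)
      f₁ e f₂ f₃ f₄ : ++-Solver.Expr 5
      f₁ = var zero
      e = var (suc zero)
      f₂ = var (suc (suc zero))
      f₃ = var (suc (suc (suc zero)))
      f₄ = var (suc (suc (suc (suc zero))))
      rearranged : P ++ s′ ∷ Q ↭ F₁ ++ s′ ∷ F₂ ++ F₃ ++ F₄
      rearranged = ↭-trans (++⁺ (filter-partition-↭ LeftSupported? P)
                                (↭-prep s′ (filter-partition-↭ LeftSupported? Q)))
        (++-Solver.prove 5 ((f₁ ⊕ f₃) ⊕ (e ⊕ (f₄ ⊕ f₂)))
                           (f₁ ⊕ (e ⊕ (f₂ ⊕ (f₃ ⊕ f₄))))
                           (F₁ ∷ [ s′ ] ∷ F₂ ∷ F₃ ∷ F₄ ∷ []))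

    module Ascent (φ′ : Aut n) (x′ : Fin r → Aut n) (x′∈ : ∀ k → G n (x′ k))
                  (β≡ : ∀ k → β k ≡ (φ′ · x′ k) ⊳ a n k) where

      X : Fin r → Aut n
      X j = x′ (prev j)

      X∈ : ∀ j → G n (X j)
      X∈ j = x′∈ (prev j)

      β̂≡ : ∀ j → β̂ j ≡ (φ′ · X j) ⊳ a n (prev j)
      β̂≡ j = trans (cong β̂ (sym (next-prev j))) (β≡ (prev j))

      φ : Aut (suc n)
      φ = node φ′ (d zero · φ′) false

      -- φ · (X s′ , E · X s′)σ conjugates a_s to b s′ (E-shift); the second section relation shows
      -- E ∈ G_n (E-factorisation).
      E : Aut n
      E = φ′ ⁻¹ · d zero ⁻¹ · δ · φ′

      E-shift : ∀ y → (d zero · φ′) · (E · y) ≡ δ · (φ′ · y)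
      E-shift y = solve ((x₀ ·ᵉ x₁) ·ᵉ ((x₁ ⁻¹ᵉ ·ᵉ x₀ ⁻¹ᵉ ·ᵉ x₂ ·ᵉ x₁) ·ᵉ x₃)) (x₂ ·ᵉ (x₁ ·ᵉ x₃)) refl
                        (d zero ∷ φ′ ∷ δ ∷ y ∷ [])

      G∩Rist : Aut n → Set
      G∩Rist y = G n y × Rist n y

      G∩Rist-idA : G∩Rist idA
      G∩Rist-idA = InGn-idA , Rist-idA n

      G∩Rist-prod : ∀ (f : Fin r → Aut n) {Y} → All (G∩Rist ∘ f) Y → G∩Rist (prod f Y)
      G∩Rist-prod f [] = G∩Rist-idA
      G∩Rist-prod f ((g , m) ∷ rest) =
        let gs , ms = G∩Rist-prod f rest in InGn-· g gs , Rist-· n m ms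

      untwist-β̂ : ∀ j → φ′ ⁻¹ ⊳ β̂ j ≡ X j ⊳ a n (prev j)
      untwist-β̂ j = trans (cong (φ′ ⁻¹ ⊳_) (β̂≡ j))
        (solve (x₀ ⁻¹ᵉ ·ᵉ ((x₀ ·ᵉ x₁) ·ᵉ x₂ ·ᵉ (x₀ ·ᵉ x₁) ⁻¹ᵉ) ·ᵉ x₀ ⁻¹ᵉ ⁻¹ᵉ) (x₁ ·ᵉ x₂ ·ᵉ x₁ ⁻¹ᵉ) refl
               (φ′ ∷ X j ∷ a n (prev j) ∷ []))

      G∩Rist-part : ∀ {j y} → Passive j → y ≡ idA ⊎ y ≡ β̂ j → G∩Rist (φ′ ⁻¹ ⊳ y)
      G∩Rist-part _ (inj₁ refl) = subst G∩Rist (sym (⊳-idA (φ′ ⁻¹))) G∩Rist-idA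
      G∩Rist-part {j} p (inj₂ refl) = subst G∩Rist (sym (untwist-β̂ j))
        (InGn-⊳ (X∈ j) (InGn-gen (prev j)) , Rist-⊳ n (X∈ j) (Rist-a n p))

      P̂ Q̂ Ĝ : Aut n
      P̂ = φ′ ⁻¹ ⊳ p₀
      Q̂ = φ′ ⁻¹ ⊳ δ ⁻¹ ⊳ q₁
      Ĝ = X s′ ⊳ a n (prev s′)

      P̂∈ : G∩Rist P̂
      P̂∈ = subst G∩Rist (prod-⊳ (φ′ ⁻¹) c P)
                 (G∩Rist-prod _ (All.map (λ p → G∩Rist-part p (left-part p)) P-passive))

      Q̂∈ : G∩Rist Q̂
      Q̂∈ = subst G∩Rist
                 (trans (prod-⊳ (φ′ ⁻¹) (λ j → δ ⁻¹ ⊳ d j) Q) (cong (φ′ ⁻¹ ⊳_) (prod-⊳ (δ ⁻¹) d Q)))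
                 (G∩Rist-prod _ (All.map (λ p → G∩Rist-part p (right-part p)) Q-passive))

      Ĝ∈ : G n Ĝ
      Ĝ∈ = InGn-⊳ (X∈ s′) (InGn-gen (prev s′))

      E-factorisation : E ≡ P̂ · Ĝ · Q̂
      E-factorisation = begin
        φ′ ⁻¹ · d zero ⁻¹ · δ · φ′
          ≡⟨ cong (λ t → φ′ ⁻¹ · t · δ · φ′) (sym d₀⁻¹≡) ⟩
        φ′ ⁻¹ · (p₀ · (c s′ · q₁)) · δ · φ′
          ≡⟨ solve (x₀ ⁻¹ᵉ ·ᵉ (x₁ ·ᵉ (x₂ ·ᵉ x₃)) ·ᵉ x₄ ·ᵉ x₀)
                   ((x₀ ⁻¹ᵉ ·ᵉ x₁ ·ᵉ x₀ ⁻¹ᵉ ⁻¹ᵉ) ·ᵉ (x₀ ⁻¹ᵉ ·ᵉ (x₂ ·ᵉ x₄) ·ᵉ x₀ ⁻¹ᵉ ⁻¹ᵉ)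
                     ·ᵉ (x₀ ⁻¹ᵉ ·ᵉ (x₄ ⁻¹ᵉ ·ᵉ x₃ ·ᵉ x₄ ⁻¹ᵉ ⁻¹ᵉ) ·ᵉ x₀ ⁻¹ᵉ ⁻¹ᵉ)) refl
                   (φ′ ∷ p₀ ∷ c s′ ∷ q₁ ∷ δ ∷ []) ⟩
        P̂ · φ′ ⁻¹ ⊳ (c s′ · δ) · Q̂
          ≡⟨ cong (λ t → P̂ · t · Q̂) (trans (cong (φ′ ⁻¹ ⊳_) (sym β̂-s′)) (untwist-β̂ s′)) ⟩
        P̂ · Ĝ · Q̂ ∎
        where
        d₀⁻¹≡ : p₀ · (c s′ · q₁) ≡ d zero ⁻¹
        d₀⁻¹≡ = AutProperties.inverseʳ-unique _ _ (proj₂ section-relations)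

      E∈ : G n E
      E∈ = subst (G n) (sym E-factorisation) (InGn-· (InGn-· (proj₁ P̂∈) Ĝ∈) (proj₁ Q̂∈))

      Rist-s′ : Rist n (X s′ · a n (prev s′) · (E · X s′) ⁻¹)
      Rist-s′ = subst (Rist n) (sym twisted≡)
                      (Rist-· n (Rist-⊳ n Ĝ∈ (Rist-⁻¹ n (proj₂ Q̂∈))) (Rist-⁻¹ n (proj₂ P̂∈)))
        where
        twisted≡ : X s′ · a n (prev s′) · (E · X s′) ⁻¹ ≡ Ĝ ⊳ Q̂ ⁻¹ · P̂ ⁻¹
        twisted≡ = begin
          X s′ · a n (prev s′) · (E · X s′) ⁻¹
            ≡⟨ solve (x₀ ·ᵉ x₁ ·ᵉ (x₂ ·ᵉ x₀) ⁻¹ᵉ) ((x₀ ·ᵉ x₁ ·ᵉ x₀ ⁻¹ᵉ) ·ᵉ x₂ ⁻¹ᵉ) refl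
                     (X s′ ∷ a n (prev s′) ∷ E ∷ []) ⟩
          Ĝ · E ⁻¹
            ≡⟨ cong (λ t → Ĝ · t ⁻¹) E-factorisation ⟩
          Ĝ · (P̂ · Ĝ · Q̂) ⁻¹
            ≡⟨ solve (x₀ ·ᵉ (x₁ ·ᵉ x₀ ·ᵉ x₂) ⁻¹ᵉ) ((x₀ ·ᵉ x₂ ⁻¹ᵉ ·ᵉ x₀ ⁻¹ᵉ) ·ᵉ x₁ ⁻¹ᵉ) refl (Ĝ ∷ P̂ ∷ Q̂ ∷ []) ⟩
          Ĝ ⊳ Q̂ ⁻¹ · P̂ ⁻¹ ∎

      Lift : Fin r → Set
      Lift j = ∃ λ x → G (suc n) x × b j ≡ (φ · x) ⊳ a (suc n) j

      lift-zero : Lift zero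
      lift-zero = Δ (X zero) , diagonal∈ n (X∈ zero) , (begin
        b zero
          ≡⟨ active-reconstruction (proj₁ active-zero) (β̂≡ zero) (·-assoc (d zero) φ′ (X zero)) ⟩
        (φ · Δ (X zero)) ⊳ node (a n (prev zero)) idA true
          ≡⟨ cong ((φ · Δ (X zero)) ⊳_) (sym (a-zero n)) ⟩
        (φ · Δ (X zero)) ⊳ a (suc n) zero ∎)

      lift-s′ : Lift s′
      lift-s′ = x , active-lift n (InGn-· E∈ (X∈ s′)) Rist-s′ , (begin
        b s′
          ≡⟨ active-reconstruction (proj₁ active-s′) (trans (sym β̂-s′) (β̂≡ s′)) (E-shift (X s′)) ⟩
        (φ · x) ⊳ node idA (a n (prev s′)) true
          ≡⟨ cong ((φ · x) ⊳_) (sym (a-s′ n)) ⟩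
        (φ · x) ⊳ a (suc n) s′ ∎)
        where x = node (X s′) (E · X s′) true

      lift-one-sided : ∀ {j y} → GConj (suc n) y (a (suc n) j) → b j ≡ φ ⊳ y → Lift j
      lift-one-sided {j} (x , x∈ , refl) b≡ = x , x∈ , trans b≡ (sym (⊳-· φ x (a (suc n) j)))

      passive-node : ∀ {j} → Passive j → b j ≡ node (c j) (d j) false
      passive-node {j} p =
        trans (node-η (b j)) (cong (node (c j) (d j)) (proj₁ (passive-one-sided p)))

      lift-left : ∀ {j} → Passive j → d j ≡ idA → Lift j
      lift-left {j} p d≡idA = lift-one-sided (one-sided-left n p (X∈ j))
        (trans (passive-node p) (node-cong
          (trans (sym (β̂-left p d≡idA)) (trans (β̂≡ j) (⊳-· φ′ (X j) _)))
          (trans d≡idA (sym (⊳-idA (d zero · φ′))))))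

      lift-right : ∀ {j} → Passive j → d j ≢ idA → Lift j
      lift-right {j} p d≢idA = lift-one-sided (one-sided-right n p (InGn-· E∈ (X∈ j)))
        (trans (passive-node p) (node-cong (trans (right-supported p d≢idA) (sym (⊳-idA φ′))) d≡))
        where
        A = a n (prev j)
        d≡ : d j ≡ (d zero · φ′) ⊳ (E · X j) ⊳ A
        d≡ = begin
          d j                             ≡⟨ solve x₀ (x₁ ·ᵉ (x₁ ⁻¹ᵉ ·ᵉ x₀ ·ᵉ x₁ ⁻¹ᵉ ⁻¹ᵉ) ·ᵉ x₁ ⁻¹ᵉ) refl
                                                     (d j ∷ δ ∷ []) ⟩
          δ ⊳ δ ⁻¹ ⊳ d j                  ≡⟨ cong (δ ⊳_) (trans (sym (β̂-right p d≢idA)) (β̂≡ j)) ⟩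
          δ ⊳ (φ′ · X j) ⊳ A              ≡⟨ sym (⊳-· δ (φ′ · X j) A) ⟩
          (δ · (φ′ · X j)) ⊳ A            ≡⟨ cong (_⊳ A) (sym (E-shift (X j))) ⟩
          ((d zero · φ′) · (E · X j)) ⊳ A ≡⟨ ⊳-· (d zero · φ′) (E · X j) A ⟩
          (d zero · φ′) ⊳ (E · X j) ⊳ A   ∎

      lift : ∀ j → Lift j
      lift j with j ≟ zero | j ≟ s′
      ... | yes refl | _ = lift-zero
      ... | no _ | yes refl = lift-s′
      ... | no j≢0 | no j≢s′ with LeftSupported? j
      ...   | yes d≡idA = lift-left (j≢0 , j≢s′) d≡idA
      ...   | no d≢idA = lift-right (j≢0 , j≢s′) d≢idA

      solution : Solution (suc n) b
      solution = φ , proj₁ ∘ lift , proj₁ ∘ proj₂ ∘ lift , proj₂ ∘ proj₂ ∘ lift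

  relation⇒solution : ∀ n (b : Fin r → Aut n) → (∀ i → Conj (b i) (a n i)) →
                      ∀ {ℓ} → IsListing ℓ → prod b ℓ ≡ idA → Solution n b
  relation⇒solution zero b _ _ _ =
    idA , (λ _ → idA) , (λ _ → InGn-idA) , (λ i → Aut-zero-trivial (b i))
  relation⇒solution (suc n) b b∼a listing rel
    with P , Q , listing′ , rel′ , P-passive , Q-passive ← cyclic-normal-form b s′≢0 listing rel =
    let open Descent n b b∼a P Q P-passive Q-passive listing′ rel′
        φ′ , x′ , x′∈ , β≡ = relation⇒solution n β β∼ β-listing β-relation
    in Ascent.solution φ′ x′ x′∈ β≡

proposition4p7 : (r s : ℕ) → 3 ≤ r → 1 < s → s ≤ r → (n : ℕ) → 1 ≤ n →
    (b : Fin r → Aut n) →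
    (∀ i → Conj (b i) (a∣ r s n i)) →
    (∃ λ (τ : Permutation′ r) → prodFin (λ k → b (τ ⟨$⟩ʳ k)) ≡ idA) →
    ∃ λ (φ : Aut n) → ∃ λ (x : Fin r → Aut n) →
      (∀ i → InGn r s n (x i)) ×
      (∀ i → b i ≡ (φ · x i) · a∣ r s n i · (φ · x i) ⁻¹)
proposition4p7 zero _ () _ _ _ _ _ _ _
proposition4p7 (suc r′) zero _ () _ _ _ _ _ _
proposition4p7 (suc r′) (suc s₀) _ (s≤s 1≤s₀) s₀<r n _ b b∼a (τ , rel) =
  relation⇒solution n b b∼a (map-listing τ (allFin-listing (suc r′)))
                    (trans (prod-map b (τ ⟨$⟩ʳ_) (allFin (suc r′))) rel)
  where
  s′ : Fin (suc r′)
  s′ = fromℕ< s₀<r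
  s′≢0 : s′ ≢ zero
  s′≢0 s′≡0 = ℕ.<⇒≢ 1≤s₀ (sym (trans (sym (Fin.toℕ-fromℕ< s₀<r)) (cong toℕ s′≡0)))
  open Generators r′ (suc s₀) s′ (cong suc (Fin.toℕ-fromℕ< s₀<r)) s′≢0
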